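{- Let $S$ be a sorting sequence of length $p$ with $r>1$ distinct values, and let $k\ge1$ be the pile size. The sorting strategy with outcome $S$ discreetly proves that there are $f$ fake coins if and only if the sorting strategy with outcome the reverse sequence $S'$ discreetly proves that there are $pk-f$ fake coins.
   Context: There are $pk$ labelled coins in $p$ piles of $k$ coins; each coin is real or fake, fake coins lighter (equal weights within each type). A sorting sequence of length $p$ is a non-decreasing sequence of $p$ non-negative integers beginning with $0$ in which each entry equals the previous one or exceeds it by $1$; it records the outcome of sorting the piles by weight (heaviest first; equal piles equal entries, a strictly lighter pile an entry one larger). If the distinct entries are $0,\dots,r-1$, let $p_i\ge1$ be the number of entries equal to $i-1$; a configuration consistent with the outcome has the same number $f_i$ of fake coins in each pile marked $i-1$, with $0\le f_1<\dots<f_r\le k$. The reverse sequence $S'$ is the sorting sequence of length $p$ with $r$ distinct values in which the number of entries equal to $i-1$ is $p_{r-i+1}$. The strategy discreetly proves that there are $f$ fake coins if for every coin there is a consistent configuration with exactly $f$ fake coins in which that coin is fake and one in which it is real. -}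

module Defs where

open import Data.Nat using (ℕ; zero; suc; _+_; _<_)
open import Data.Fin using (Fin; toℕ)
import Data.Fin as F
open import Data.Bool using (Bool; true; false)
open import Data.Product using (_×_; ∃; ∃-syntax)
open import Data.Sum using (_⊎_)
open import Relation.Binary.PropositionalEquality using (_≡_)
open import Relation.Nullary.Decidable using (⌊_⌋)
open import Function.Bundles using (_⇔_)
import Data.Nat as N

countTrue : ∀ {n} → (Fin n → Bool) → ℕ
countTrue {zero} P = 0
countTrue {suc n} P with P F.zero
... | true  = suc (countTrue (λ i → P (F.suc i)))
... | false = countTrue (λ i → P (F.suc i))

sumF : ∀ {n} → (Fin n → ℕ) → ℕ
sumF {zero} g = 0
sumF {suc n} g = g F.zero + sumF (λ i → g (F.suc i))

IsSortingSeq : ∀ {p} → (Fin p → ℕ) → Set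
IsSortingSeq {p} S =
  (∀ (i : Fin p) → toℕ i ≡ 0 → S i ≡ 0) ×
  (∀ (i j : Fin p) → toℕ j ≡ suc (toℕ i) → (S j ≡ S i ⊎ S j ≡ suc (S i)))

HasDistinctValues : ∀ {p} → (Fin p → ℕ) → ℕ → Set
HasDistinctValues {p} S r = ∀ (v : ℕ) → (v < r ⇔ (∃[ i ] S i ≡ v))

multiplicity : ∀ {p} → (Fin p → ℕ) → ℕ → ℕ
multiplicity S v = countTrue (λ i → ⌊ S i N.≟ v ⌋)

-- S' is the reverse sequence of S (S having r distinct values):
-- S' is a sorting sequence of the same length with r distinct values, and
-- the number of entries of S' equal to i-1 is p_{r-i+1}, i.e. the number of
-- entries of S equal to r-i.  (Indexing by v = i-1: value v of S' has the
-- multiplicity of value (r-1)-v of S.)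
IsReverse : ∀ {p} → (Fin p → ℕ) → ℕ → (Fin p → ℕ) → Set
IsReverse {p} S r S' =
  IsSortingSeq S' × HasDistinctValues S' r ×
  (∀ (v : ℕ) → v < r → multiplicity S' v ≡ multiplicity S (r N.∸ 1 N.∸ v))

-- A configuration of p piles of k coins: true = fake, false = real.
Config : ℕ → ℕ → Set
Config p k = Fin p → Fin k → Bool

fakesInPile : ∀ {p k} → Config p k → Fin p → ℕ
fakesInPile c a = countTrue (c a)

totalFakes : ∀ {p k} → Config p k → ℕ
totalFakes c = sumF (fakesInPile c)

-- The configuration is consistent with the sorting outcome S
-- (heaviest first; fake coins lighter, so more fakes = lighter = larger entry).
Consistent : ∀ {p k} → (Fin p → ℕ) → Config p k → Set
Consistent {p} S c =
  ∀ (a b : Fin p) →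
    (S a ≡ S b → fakesInPile c a ≡ fakesInPile c b) ×
    (S a < S b → fakesInPile c a < fakesInPile c b)

DiscreetlyProves : ∀ {p} (k : ℕ) → (Fin p → ℕ) → ℕ → Set
DiscreetlyProves {p} k S f =
  ∀ (a : Fin p) (j : Fin k) →
    (∃[ c ] (Consistent S c × totalFakes {p} {k} c ≡ f × c a j ≡ true)) ×
    (∃[ c ] (Consistent S c × totalFakes {p} {k} c ≡ f × c a j ≡ false))

-- Complementing every coin (fake ↔ real) turns a configuration with f fakes
-- into one with pk − f fakes and reverses the weight order of the piles.
-- Sending each pile of S' at level w to a pile of S at level r − 1 − w, the
-- complement of a configuration consistent with S is consistent with S'.  Its
-- total is pk − f because the number of fakes in a pile depends only on its
-- level, and level w of S' has as many piles as level r − 1 − w of S.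
-- Conversely, no strategy discreetly proves that there are 0 fake coins, so
-- pk − f > 0 and applying the same construction to (S', S) recovers f.
module Submission where

open import Defs
open import Data.Nat using (ℕ; _*_; _∸_; _<_; _≤_)
open import Data.Fin using (Fin)
open import Function.Bundles using (_⇔_)

open import Data.Nat using (zero; suc; _+_; _⊓_; s≤s; z≤n; _≟_)
open import Data.Nat.Properties
open import Data.Fin using (toℕ; opposite) renaming (zero to fzero; suc to fsuc)
open import Data.Fin.Properties using (toℕ<n; opposite-prop)
import Data.Fin.Permutation as Perm
open import Data.Bool using (Bool; true; false; not; if_then_else_)
open import Data.Product using (_×_; _,_; proj₁; proj₂; ∃-syntax)
open import Function.Base using (_∘_)
open import Function.Bundles using (mk⇔; Equivalence)
open import Relation.Binary.PropositionalEquality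
open import Relation.Nullary using (yes; no; contradiction)
open import Relation.Nullary.Decidable using (⌊_⌋)
open import Algebra.Properties.CommutativeMonoid.Sum +-0-commutativeMonoid
  using (sum; sum-syntax; sum-cong-≗; sum-replicate-zero; ∑-distrib-+; ∑-permute)

open ≡-Reasoning

countTrue-not+countTrue : ∀ {k} (P : Fin k → Bool) →
  countTrue (not ∘ P) + countTrue P ≡ k
countTrue-not+countTrue {zero} P = refl
countTrue-not+countTrue {suc k} P with P fzero
... | true  = trans (+-suc _ _) (cong suc (countTrue-not+countTrue (P ∘ fsuc)))
... | false = cong suc (countTrue-not+countTrue (P ∘ fsuc))

countTrue-not : ∀ {k} (P : Fin k → Bool) → countTrue (not ∘ P) ≡ k ∸ countTrue P
countTrue-not {k} P = begin
  countTrue (not ∘ P)                            ≡⟨ m+n∸n≡m _ (countTrue P) ⟨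
  countTrue (not ∘ P) + countTrue P ∸ countTrue P
    ≡⟨ cong (_∸ countTrue P) (countTrue-not+countTrue P) ⟩
  k ∸ countTrue P                                ∎

countTrue≤ : ∀ {k} (P : Fin k → Bool) → countTrue P ≤ k
countTrue≤ {k} P = subst (countTrue P ≤_) (countTrue-not+countTrue P) (m≤n+m _ _)

countTrue-pos : ∀ {k} (P : Fin k → Bool) (j : Fin k) → P j ≡ true → 0 < countTrue P
countTrue-pos {suc k} P j Pj≡true with P fzero in P0
... | true = s≤s z≤n
countTrue-pos {suc k} P fzero    Pj≡true | false with () ← trans (sym P0) Pj≡true
countTrue-pos {suc k} P (fsuc j) Pj≡true | false = countTrue-pos (P ∘ fsuc) j Pj≡true

sumF≡sum : ∀ {n} (g : Fin n → ℕ) → sumF g ≡ sum g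
sumF≡sum {zero} g = refl
sumF≡sum {suc n} g = cong (g fzero +_) (sumF≡sum (g ∘ fsuc))

totalFakes≡sum : ∀ {p k} (c : Config p k) → totalFakes c ≡ sum (fakesInPile c)
totalFakes≡sum c = sumF≡sum (fakesInPile c)

≤-sum : ∀ {n} (g : Fin n → ℕ) (a : Fin n) → g a ≤ sum g
≤-sum g fzero = m≤m+n _ _
≤-sum g (fsuc a) = ≤-trans (≤-sum (g ∘ fsuc) a) (m≤n+m _ _)

sum-complement+sum : ∀ {n} k (x : Fin n → ℕ) → (∀ a → x a ≤ k) →
  sum (λ a → k ∸ x a) + sum x ≡ n * k
sum-complement+sum {n} k x x≤k = begin
  sum (λ a → k ∸ x a) + sum x ≡⟨ ∑-distrib-+ (λ a → k ∸ x a) x ⟨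
  sum (λ a → k ∸ x a + x a)   ≡⟨ sum-cong-≗ {n} (λ a → m∸n+n≡m (x≤k a)) ⟩
  ∑[ _ < n ] k                ≡⟨ sum-const n ⟩
  n * k                       ∎
  where
  sum-const : ∀ n → sum {n} (λ _ → k) ≡ n * k
  sum-const zero = refl
  sum-const (suc n) = cong (k +_) (sum-const n)

sum-complement : ∀ {n} k (x : Fin n → ℕ) → (∀ a → x a ≤ k) →
  sum (λ a → k ∸ x a) ≡ n * k ∸ sum x
sum-complement {n} k x x≤k = begin
  sum (λ a → k ∸ x a)                 ≡⟨ m+n∸n≡m _ (sum x) ⟨
  sum (λ a → k ∸ x a) + sum x ∸ sum x ≡⟨ cong (_∸ sum x) (sum-complement+sum k x x≤k) ⟩
  n * k ∸ sum x                       ∎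

∑-reverse : ∀ n (H : ℕ → ℕ) → ∑[ w < suc n ] H (n ∸ toℕ w) ≡ ∑[ w < suc n ] H (toℕ w)
∑-reverse n H = begin
  ∑[ w < suc n ] H (n ∸ toℕ w)          ≡⟨ sum-cong-≗ {suc n} (cong H ∘ opposite-prop) ⟨
  ∑[ w < suc n ] H (toℕ (opposite w))   ≡⟨ ∑-permute (H ∘ toℕ) Perm.reverse ⟨
  ∑[ w < suc n ] H (toℕ w)              ∎

indicator : ℕ → ℕ → ℕ
indicator x w = if ⌊ x ≟ w ⌋ then 1 else 0

indicator-suc : ∀ x w → indicator (suc x) (suc w) ≡ indicator x w
indicator-suc x w with x ≟ w | suc x ≟ suc w
... | yes _    | yes _      = refl
... | no _     | no _       = refl
... | yes x≡w  | no sx≢sw   = contradiction (cong suc x≡w) sx≢sw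
... | no x≢w   | yes sx≡sw  = contradiction (suc-injective sx≡sw) x≢w

multiplicity-suc : ∀ {p} (T : Fin (suc p) → ℕ) w →
  multiplicity T w ≡ indicator (T fzero) w + multiplicity (T ∘ fsuc) w
multiplicity-suc T w with ⌊ T fzero ≟ w ⌋
... | true  = refl
... | false = refl

∑-indicator : ∀ R x (G : ℕ → ℕ) → x < R →
  ∑[ w < R ] (indicator x (toℕ w) * G (toℕ w)) ≡ G x
∑-indicator (suc R) zero G _ = begin
  G 0 + 0 + ∑[ w < R ] 0 ≡⟨ cong (G 0 + 0 +_) (sum-replicate-zero R) ⟩
  G 0 + 0 + 0            ≡⟨ +-identityʳ _ ⟩
  G 0 + 0                ≡⟨ +-identityʳ _ ⟩
  G 0                    ∎
∑-indicator (suc R) (suc x) G (s≤s x<R) = begin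
  ∑[ w < R ] (indicator (suc x) (suc (toℕ w)) * G (suc (toℕ w)))
    ≡⟨ sum-cong-≗ {R} (λ w → cong (_* G (suc (toℕ w))) (indicator-suc x (toℕ w))) ⟩
  ∑[ w < R ] (indicator x (toℕ w) * G (suc (toℕ w)))
    ≡⟨ ∑-indicator R x (G ∘ suc) x<R ⟩
  G (suc x)
    ∎

sum-by-levels : ∀ {p} (T : Fin p → ℕ) R (G : ℕ → ℕ) → (∀ a → T a < R) →
  sum (G ∘ T) ≡ ∑[ w < R ] (multiplicity T (toℕ w) * G (toℕ w))
sum-by-levels {zero} T R G _ = sym (sum-replicate-zero R)
sum-by-levels {suc p} T R G T<R = begin
  G (T fzero) + sum (G ∘ T ∘ fsuc)
    ≡⟨ cong₂ _+_ (sym (∑-indicator R (T fzero) G (T<R fzero)))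
                 (sum-by-levels (T ∘ fsuc) R G (T<R ∘ fsuc)) ⟩
  sum first + sum rest
    ≡⟨ ∑-distrib-+ first rest ⟨
  ∑[ w < R ] (first w + rest w)
    ≡⟨ sum-cong-≗ {R} split ⟨
  ∑[ w < R ] (multiplicity T (toℕ w) * G (toℕ w))
    ∎
  where
  first rest : Fin R → ℕ
  first w = indicator (T fzero) (toℕ w) * G (toℕ w)
  rest w = multiplicity (T ∘ fsuc) (toℕ w) * G (toℕ w)
  split : ∀ w → multiplicity T (toℕ w) * G (toℕ w) ≡ first w + rest w
  split w = trans (cong (_* G (toℕ w)) (multiplicity-suc T (toℕ w)))
    (*-distribʳ-+ (G (toℕ w)) (indicator (T fzero) (toℕ w)) (multiplicity (T ∘ fsuc) (toℕ w)))

values< : ∀ {p} {S : Fin p → ℕ} {r} → HasDistinctValues S r → ∀ a → S a < r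
values< hd a = Equivalence.from (hd _) (a , refl)

DiscreetlyProves⇒0< : ∀ {p k} {S : Fin p → ℕ} {f} → Fin p → Fin k →
  DiscreetlyProves k S f → 0 < f
DiscreetlyProves⇒0< a j dp with proj₁ (dp a j)
... | c , _ , total≡f , cj≡true =
  <-≤-trans (countTrue-pos (c a) j cj≡true)
    (subst (fakesInPile c a ≤_) (trans (sym (totalFakes≡sum c)) total≡f) (≤-sum (fakesInPile c) a))

-- Definitionally the last component of IsReverse S (suc r′) S′, as suc r′ ∸ 1 reduces to r′.
MultiplicitiesReversed : ∀ {p} → ℕ → (Fin p → ℕ) → (Fin p → ℕ) → Set
MultiplicitiesReversed r′ S S′ = ∀ w → w < suc r′ → multiplicity S′ w ≡ multiplicity S (r′ ∸ w)

MultiplicitiesReversed-sym : ∀ {p} {S S′ : Fin p → ℕ} r′ →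
  MultiplicitiesReversed r′ S S′ → MultiplicitiesReversed r′ S′ S
MultiplicitiesReversed-sym {S = S} {S′} r′ mirrored w (s≤s w≤r′) = sym (begin
  multiplicity S′ (r′ ∸ w)         ≡⟨ mirrored (r′ ∸ w) (s≤s (m∸n≤m r′ w)) ⟩
  multiplicity S (r′ ∸ (r′ ∸ w))   ≡⟨ cong (multiplicity S) (m∸[m∸n]≡n w≤r′) ⟩
  multiplicity S w                 ∎)

module Reversal {p} (k r′ : ℕ) (S S′ : Fin p → ℕ)
  (distinctS : HasDistinctValues S (suc r′)) (distinctS′ : HasDistinctValues S′ (suc r′))
  (mirrored : MultiplicitiesReversed r′ S S′) where

  -- Clamping the level to r′ makes the choice total, so no default pile is needed.
  pileAtLevel : ℕ → Fin p
  pileAtLevel v = proj₁ (Equivalence.to (distinctS (v ⊓ r′)) (s≤s (m⊓n≤n v r′)))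

  S-pileAtLevel : ∀ {v} → v ≤ r′ → S (pileAtLevel v) ≡ v
  S-pileAtLevel {v} v≤r′ =
    trans (proj₂ (Equivalence.to (distinctS (v ⊓ r′)) (s≤s (m⊓n≤n v r′)))) (m≤n⇒m⊓n≡m v≤r′)

  mirror : Fin p → Fin p
  mirror b = pileAtLevel (r′ ∸ S′ b)

  S-mirror : ∀ b → S (mirror b) ≡ r′ ∸ S′ b
  S-mirror b = S-pileAtLevel (m∸n≤m r′ (S′ b))

  complement : Config p k → Config p k
  complement c b j = not (c (mirror b) j)

  fakes-complement : ∀ c b → fakesInPile (complement c) b ≡ k ∸ fakesInPile c (mirror b)
  fakes-complement c b = countTrue-not (c (mirror b))

  module _ (c : Config p k) (consistent : Consistent S c) where

    consistent-complement : Consistent S′ (complement c)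
    consistent-complement a b = same-level , lower-level
      where
      same-level : S′ a ≡ S′ b → fakesInPile (complement c) a ≡ fakesInPile (complement c) b
      same-level S′a≡S′b = begin
        fakesInPile (complement c) a   ≡⟨ fakes-complement c a ⟩
        k ∸ fakesInPile c (mirror a)
          ≡⟨ cong (k ∸_) (proj₁ (consistent (mirror a) (mirror b)) mirror-levels) ⟩
        k ∸ fakesInPile c (mirror b)   ≡⟨ fakes-complement c b ⟨
        fakesInPile (complement c) b   ∎
        where
        mirror-levels : S (mirror a) ≡ S (mirror b)
        mirror-levels = trans (S-mirror a) (trans (cong (r′ ∸_) S′a≡S′b) (sym (S-mirror b)))
      lower-level : S′ a < S′ b → fakesInPile (complement c) a < fakesInPile (complement c) b
      lower-level S′a<S′b = subst₂ _<_ (sym (fakes-complement c a)) (sym (fakes-complement c b))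
        (∸-monoʳ-< (proj₂ (consistent (mirror b) (mirror a)) mirror-levels) (countTrue≤ (c (mirror a))))
        where
        mirror-levels : S (mirror b) < S (mirror a)
        mirror-levels = subst₂ _<_ (sym (S-mirror b)) (sym (S-mirror a))
          (∸-monoʳ-< S′a<S′b (≤-pred (values< distinctS′ b)))

    levelFakes : ℕ → ℕ
    levelFakes v = fakesInPile c (pileAtLevel v)

    fakes≡levelFakes : ∀ a → fakesInPile c a ≡ levelFakes (S a)
    fakes≡levelFakes a =
      proj₁ (consistent a _) (sym (S-pileAtLevel (≤-pred (values< distinctS a))))

    totalFakes-complement : totalFakes (complement c) ≡ p * k ∸ totalFakes c
    totalFakes-complement = begin
      totalFakes (complement c)
        ≡⟨ totalFakes≡sum (complement c) ⟩
      sum (λ b → fakesInPile (complement c) b)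
        ≡⟨ sum-cong-≗ (fakes-complement c) ⟩
      sum (λ b → k ∸ levelFakes (r′ ∸ S′ b))
        ≡⟨ sum-by-levels S′ (suc r′) (λ w → k ∸ levelFakes (r′ ∸ w)) (values< distinctS′) ⟩
      ∑[ w < suc r′ ] (multiplicity S′ (toℕ w) * (k ∸ levelFakes (r′ ∸ toℕ w)))
        ≡⟨ sum-cong-≗ {suc r′} (λ w →
             cong (_* (k ∸ levelFakes (r′ ∸ toℕ w))) (mirrored (toℕ w) (toℕ<n w))) ⟩
      ∑[ w < suc r′ ] (multiplicity S (r′ ∸ toℕ w) * (k ∸ levelFakes (r′ ∸ toℕ w)))
        ≡⟨ ∑-reverse r′ (λ v → multiplicity S v * (k ∸ levelFakes v)) ⟩
      ∑[ w < suc r′ ] (multiplicity S (toℕ w) * (k ∸ levelFakes (toℕ w)))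
        ≡⟨ sum-by-levels S (suc r′) (λ v → k ∸ levelFakes v) (values< distinctS) ⟨
      sum (λ a → k ∸ levelFakes (S a))
        ≡⟨ sum-cong-≗ (cong (k ∸_) ∘ fakes≡levelFakes) ⟨
      sum (λ a → k ∸ fakesInPile c a)
        ≡⟨ sum-complement k (fakesInPile c) (countTrue≤ ∘ c) ⟩
      p * k ∸ sum (fakesInPile c)
        ≡⟨ cong (p * k ∸_) (totalFakes≡sum c) ⟨
      p * k ∸ totalFakes c
        ∎

  DiscreetlyProves-reverse : ∀ {f} → DiscreetlyProves k S f → DiscreetlyProves k S′ (p * k ∸ f)
  DiscreetlyProves-reverse dp b j =
    transport (proj₂ (dp (mirror b) j)) , transport (proj₁ (dp (mirror b) j))
    where
    transport : ∀ {f x} → ∃[ c ] (Consistent S c × totalFakes c ≡ f × c (mirror b) j ≡ x) →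
      ∃[ c ] (Consistent S′ c × totalFakes c ≡ p * k ∸ f × c b j ≡ not x)
    transport (c , consistent , total≡f , cj≡x) =
      complement c , consistent-complement c consistent ,
      trans (totalFakes-complement c consistent) (cong (p * k ∸_) total≡f) , cong not cj≡x

mainTheorem14 : ∀ (p k r f : ℕ) (S S' : Fin p → ℕ) →
    IsSortingSeq S → HasDistinctValues S r → 1 < r → 1 ≤ k →
    IsReverse S r S' →
    (DiscreetlyProves k S f ⇔ DiscreetlyProves k S' (p * k ∸ f))
mainTheorem14 p k (suc r′) f S S′ _ distinctS _ (s≤s _) (_ , distinctS′ , mirrored) =
  mk⇔ (Reversal.DiscreetlyProves-reverse k r′ S S′ distinctS distinctS′ mirrored) backward
  where
  backward : DiscreetlyProves k S′ (p * k ∸ f) → DiscreetlyProves k S f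
  backward dp′ = subst (DiscreetlyProves k S) (m∸[m∸n]≡n f≤pk)
    (Reversal.DiscreetlyProves-reverse k r′ S′ S distinctS′ distinctS
      (MultiplicitiesReversed-sym {S = S} {S′} r′ mirrored) dp′)
    where
    some-pile : Fin p
    some-pile = proj₁ (Equivalence.to (distinctS 0) (s≤s z≤n))
    f≤pk : f ≤ p * k
    f≤pk = <⇒≤ (m∸n≢0⇒n<m (n>0⇒n≢0 (DiscreetlyProves⇒0< some-pile fzero dp′)))
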